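{- Let $n>1$ be an integer. If $a,b\in GP(\mathbb Z_n)$, then the join $a\vee b$ exists in the poset $(\mathbb Z_n,\leq)$, and $a\vee b\in GP(\mathbb Z_n)$.
   Context: On $\mathbb Z_n$ define the partial order $\leq$ by: $a\leq b$ iff $a=b$ or $a\equiv ab\pmod n$. $GP(\mathbb Z_n)$ is the set of $a\in\mathbb Z_n$ with $a^m=a$ for some integer $m\geq2$. -}

module Defs where

open import Data.Nat using (ℕ; zero; suc; _*_; _≤_; _%_; _∸_; NonZero)
open import Data.Nat.DivMod using (m%n<n)
open import Data.Fin using (Fin; toℕ; fromℕ<)
open import Data.Product using (Σ; _×_)
open import Data.Sum using (_⊎_)
open import Relation.Binary.PropositionalEquality using (_≡_)

module Zn (n : ℕ) .{{_ : NonZero n}} where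

  _·_ : Fin n → Fin n → Fin n
  a · b = fromℕ< (m%n<n (toℕ a * toℕ b) n)

  -- positive powers: powSuc a k = a^(k+1)  (a^1 = a, a^(k+2) = a^(k+1) · a)
  powSuc : Fin n → ℕ → Fin n
  powSuc a zero    = a
  powSuc a (suc k) = powSuc a k · a

  _≼_ : Fin n → Fin n → Set
  a ≼ b = a ≡ b ⊎ a ≡ a · b

  -- GP(ℤ_n): a^m = a for some m ≥ 2
  GP : Fin n → Set
  GP a = Σ ℕ λ m → 2 ≤ m × powSuc a (m ∸ 1) ≡ a

  IsJoin : Fin n → Fin n → Fin n → Set
  IsJoin a b j = (a ≼ j) × (b ≼ j) × ((c : Fin n) → a ≼ c → b ≼ c → j ≼ c)

-- Every a ∈ GP(ℤ_n), say a^(k+2) = a, has the idempotent e = a^(k+1) attached to it: a·e = a,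
-- and a·c = a implies e·c = e.  Idempotents are joined by e ∨ f = e + f − ef, which is again
-- idempotent.  If a and b are comparable the larger one is their join; otherwise every upper
-- bound c of a and b satisfies a·c = a and b·c = b, hence e·c = e and f·c = f, hence
-- (e ∨ f)·c = e ∨ f; so e ∨ f is the join, and it lies in GP(ℤ_n) being idempotent.
module Submission where

open import Defs
open import Data.Nat using (ℕ; suc; _+_; _*_; _^_; _%_; _<_; pred; NonZero; s≤s; z≤n)
open import Data.Nat.Properties using (*-comm; *-identityʳ; +-assoc; suc-pred)
open import Data.Nat.DivMod using (m%n<n; m%n%n≡m%n; m<n⇒m%n≡m; %-distribˡ-+; %-distribˡ-*; [m+kn]%n≡m%n)
open import Data.Nat.Tactic.RingSolver using (solve-∀)
open import Data.Fin using (Fin; toℕ; fromℕ<; _≟_)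
open import Data.Fin.Properties using (toℕ-injective; toℕ<n; toℕ-fromℕ<)
open import Data.Product using (Σ; _×_; _,_)
open import Data.Sum using (inj₁; inj₂)
open import Level using (0ℓ)
open import Relation.Nullary using (Dec; yes; no; ¬_; contradiction)
open import Relation.Nullary.Decidable using (_⊎-dec_)
open import Relation.Binary using (Setoid)
import Relation.Binary.Construct.On as On
open import Relation.Binary.PropositionalEquality as ≡ using (_≡_; refl; sym; trans; cong; cong₂)

module Congruence (n : ℕ) .{{_ : NonZero n}} where

  ≈-setoid : Setoid 0ℓ 0ℓ
  ≈-setoid = On.setoid (≡.setoid ℕ) (_% n)

  open Setoid ≈-setoid public using (_≈_) renaming (refl to ≈-refl; sym to ≈-sym; trans to ≈-trans)
  open import Relation.Binary.Reasoning.Setoid ≈-setoid public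

  ≡⇒≈ : ∀ {p q} → p ≡ q → p ≈ q
  ≡⇒≈ = cong (_% n)

  m%n≈m : ∀ p → p % n ≈ p
  m%n≈m p = m%n%n≡m%n p n

  +-cong : ∀ {p q r s} → p ≈ q → r ≈ s → p + r ≈ q + s
  +-cong {p} {q} {r} {s} p≈q r≈s =
    trans (%-distribˡ-+ p r n) (trans (cong₂ (λ u v → (u + v) % n) p≈q r≈s) (sym (%-distribˡ-+ q s n)))

  *-cong : ∀ {p q r s} → p ≈ q → r ≈ s → p * r ≈ q * s
  *-cong {p} {q} {r} {s} p≈q r≈s =
    trans (%-distribˡ-* p r n) (trans (cong₂ (λ u v → (u * v) % n) p≈q r≈s) (sym (%-distribˡ-* q s n)))

  *-congˡ : ∀ k {r s} → r ≈ s → k * r ≈ k * s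
  *-congˡ k = *-cong {k} ≈-refl

  *-congʳ : ∀ k {p q} → p ≈ q → p * k ≈ q * k
  *-congʳ k p≈q = *-cong p≈q (≈-refl {k})

  p+pred[n]*p≡p*n : ∀ p → p + pred n * p ≡ p * n
  p+pred[n]*p≡p*n p = trans (cong (_* p) (suc-pred n)) (*-comm n p)

module Idempotents (n : ℕ) .{{_ : NonZero n}} where
  open Congruence n

  infixr 6 _∨_
  -- pred n plays the role of −1 in ℤ_n, so this is e + f − ef.
  _∨_ : ℕ → ℕ → ℕ
  e ∨ f = e + f + pred n * (e * f)

  ∨-comm : ∀ e f → e ∨ f ≡ f ∨ e
  ∨-comm e f = swap e f (pred n)
    where
    swap : ∀ e f k → e + f + k * (e * f) ≡ f + e + k * (f * e)
    swap = solve-∀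

  *-∨-absorbˡ : ∀ {z e} f → z * e ≈ z → z * (e ∨ f) ≈ z
  *-∨-absorbˡ {z} {e} f ze≈z = begin
    z * (e ∨ f)                          ≡⟨ distrib z e f (pred n) ⟩
    z * e + z * f + pred n * (z * e * f) ≈⟨ +-cong (+-cong ze≈z ≈-refl) (*-congˡ (pred n) (*-congʳ f ze≈z)) ⟩
    z + z * f + pred n * (z * f)         ≡⟨ +-assoc z (z * f) _ ⟩
    z + (z * f + pred n * (z * f))       ≡⟨ cong (z +_) (p+pred[n]*p≡p*n (z * f)) ⟩
    z + z * f * n                        ≈⟨ [m+kn]%n≡m%n z (z * f) n ⟩
    z                                    ∎
    where
    distrib : ∀ z e f k → z * (e + f + k * (e * f)) ≡ z * e + z * f + k * (z * e * f)
    distrib = solve-∀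

  *-∨-absorbʳ : ∀ {z} e {f} → z * f ≈ z → z * (e ∨ f) ≈ z
  *-∨-absorbʳ {z} e {f} zf≈z = ≈-trans (≡⇒≈ (cong (z *_) (∨-comm e f))) (*-∨-absorbˡ e zf≈z)

  ∨-least : ∀ {e f c} → e * c ≈ e → f * c ≈ f → (e ∨ f) * c ≈ e ∨ f
  ∨-least {e} {f} {c} ec≈e fc≈f = begin
    (e ∨ f) * c                          ≡⟨ distrib e f c (pred n) ⟩
    e * c + f * c + pred n * (e * c * f) ≈⟨ +-cong (+-cong ec≈e fc≈f) (*-congˡ (pred n) (*-congʳ f ec≈e)) ⟩
    e ∨ f                                ∎
    where
    distrib : ∀ e f c k → (e + f + k * (e * f)) * c ≡ e * c + f * c + k * (e * c * f)
    distrib = solve-∀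

  ∨-idempotent : ∀ {e f} → e * e ≈ e → f * f ≈ f → (e ∨ f) * (e ∨ f) ≈ e ∨ f
  ∨-idempotent {e} {f} ee≈e ff≈f = ∨-least (*-∨-absorbˡ f ee≈e) (*-∨-absorbʳ e ff≈f)

  infix 4 _IsIdempotentOf_
  record _IsIdempotentOf_ (e x : ℕ) : Set where
    field
      idempotent : e * e ≈ e
      absorbs    : x * e ≈ x
      fixes      : ∀ c → x * c ≈ x → e * c ≈ e

  ^suc-isIdempotentOf : ∀ {x} k → x ^ suc (suc k) ≈ x → x ^ suc k IsIdempotentOf x
  ^suc-isIdempotentOf {x} k x²⁺ᵏ≈x = record
    { idempotent = begin
        x ^ suc k * x ^ suc k ≡⟨ shift x (x ^ k) ⟩
        x ^ suc (suc k) * x ^ k ≈⟨ *-congʳ (x ^ k) x²⁺ᵏ≈x ⟩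
        x ^ suc k ∎
    ; absorbs = x²⁺ᵏ≈x
    ; fixes = λ c xc≈x → begin
        x ^ suc k * c   ≡⟨ reassoc x (x ^ k) c ⟩
        x ^ k * (x * c) ≈⟨ *-congˡ (x ^ k) xc≈x ⟩
        x ^ k * x       ≡⟨ *-comm (x ^ k) x ⟩
        x ^ suc k       ∎
    }
    where
    shift : ∀ x y → x * y * (x * y) ≡ x * (x * y) * y
    shift = solve-∀
    reassoc : ∀ x y c → x * y * c ≡ y * (x * c)
    reassoc = solve-∀

module Residues (n : ℕ) .{{_ : NonZero n}} where
  open Zn n
  open Congruence n
  open Idempotents n

  [_] : ℕ → Fin n
  [ p ] = fromℕ< (m%n<n p n)

  toℕ-[] : ∀ p → toℕ [ p ] ≈ p
  toℕ-[] p = ≈-trans (≡⇒≈ (toℕ-fromℕ< (m%n<n p n))) (m%n≈m p)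

  toℕ-· : ∀ u v → toℕ (u · v) ≈ toℕ u * toℕ v
  toℕ-· u v = toℕ-[] (toℕ u * toℕ v)

  ≈⇒≡ : ∀ {u v : Fin n} → toℕ u ≈ toℕ v → u ≡ v
  ≈⇒≡ {u} {v} u≈v = toℕ-injective (trans (sym (m<n⇒m%n≡m (toℕ<n u))) (trans u≈v (m<n⇒m%n≡m (toℕ<n v))))

  ≡·⇒*≈ : ∀ {u v} → u ≡ u · v → toℕ u * toℕ v ≈ toℕ u
  ≡·⇒*≈ {u} {v} u≡uv = ≈-trans (≈-sym (toℕ-· u v)) (≡⇒≈ (cong toℕ (sym u≡uv)))

  *≈⇒≡· : ∀ {u v} → toℕ u * toℕ v ≈ toℕ u → u ≡ u · v
  *≈⇒≡· {u} {v} uv≈u = ≈⇒≡ (≈-sym (≈-trans (toℕ-· u v) uv≈u))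

  toℕ-powSuc : ∀ a k → toℕ (powSuc a k) ≈ toℕ a ^ suc k
  toℕ-powSuc a 0       = ≡⇒≈ (sym (*-identityʳ (toℕ a)))
  toℕ-powSuc a (suc k) = begin
    toℕ (powSuc a k · a)        ≈⟨ toℕ-· (powSuc a k) a ⟩
    toℕ (powSuc a k) * toℕ a    ≈⟨ *-congʳ (toℕ a) (toℕ-powSuc a k) ⟩
    toℕ a ^ suc k * toℕ a       ≡⟨ *-comm (toℕ a ^ suc k) (toℕ a) ⟩
    toℕ a ^ suc (suc k)         ∎

  GP⇒idempotent : ∀ {a} → GP a → Σ ℕ (_IsIdempotentOf (toℕ a))
  GP⇒idempotent (1 , s≤s () , _)
  GP⇒idempotent {a} (suc (suc k) , _ , aᵐ≡a) =
    toℕ a ^ suc k , ^suc-isIdempotentOf k (≈-trans (≈-sym (toℕ-powSuc a (suc k))) (≡⇒≈ (cong toℕ aᵐ≡a)))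

  idempotent⇒GP : ∀ {p} → p * p ≈ p → GP [ p ]
  idempotent⇒GP {p} pp≈p = 2 , s≤s (s≤s z≤n) , sym (*≈⇒≡· (begin
    toℕ [ p ] * toℕ [ p ] ≈⟨ *-cong (toℕ-[] p) (toℕ-[] p) ⟩
    p * p                 ≈⟨ pp≈p ⟩
    p                     ≈⟨ toℕ-[] p ⟨
    toℕ [ p ]             ∎))

  _≼?_ : ∀ u v → Dec (u ≼ v)
  u ≼? v = (u ≟ v) ⊎-dec (u ≟ u · v)

  join-of-incomparable : ∀ {a b e f} → ¬ b ≼ a → ¬ a ≼ b →
                         e IsIdempotentOf toℕ a → f IsIdempotentOf toℕ b → IsJoin a b [ e ∨ f ]
  join-of-incomparable {a} {b} {e} {f} b⋠a a⋠b eA fB =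
      inj₂ (*≈⇒≡· (≈-trans (*-congˡ (toℕ a) (toℕ-[] (e ∨ f))) (*-∨-absorbˡ f (absorbs eA))))
    , inj₂ (*≈⇒≡· (≈-trans (*-congˡ (toℕ b) (toℕ-[] (e ∨ f))) (*-∨-absorbʳ e (absorbs fB))))
    , least
    where
    open _IsIdempotentOf_
    least : ∀ c → a ≼ c → b ≼ c → [ e ∨ f ] ≼ c
    least c (inj₁ refl) b≼a           = contradiction b≼a b⋠a
    least c a≼b         (inj₁ refl)   = contradiction a≼b a⋠b
    least c (inj₂ a≡ac) (inj₂ b≡bc)   = inj₂ (*≈⇒≡· (begin
      toℕ [ e ∨ f ] * toℕ c ≈⟨ *-congʳ (toℕ c) (toℕ-[] (e ∨ f)) ⟩
      (e ∨ f) * toℕ c       ≈⟨ ∨-least (fixes eA (toℕ c) (≡·⇒*≈ a≡ac)) (fixes fB (toℕ c) (≡·⇒*≈ b≡bc)) ⟩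
      e ∨ f                 ≈⟨ toℕ-[] (e ∨ f) ⟨
      toℕ [ e ∨ f ]         ∎))

theorem3p9 : (n : ℕ) → .{{_ : NonZero n}} → 1 < n → (a b : Fin n) → Zn.GP n a → Zn.GP n b → Σ (Fin n) λ j → Zn.IsJoin n a b j × Zn.GP n j
theorem3p9 n _ a b gpA gpB = join (b ≼? a) (a ≼? b) (GP⇒idempotent gpA) (GP⇒idempotent gpB)
  where
  open Zn n
  open Idempotents n
  open Residues n
  open _IsIdempotentOf_

  join : Dec (b ≼ a) → Dec (a ≼ b) → Σ ℕ (_IsIdempotentOf (toℕ a)) → Σ ℕ (_IsIdempotentOf (toℕ b)) →
         Σ (Fin n) λ j → IsJoin a b j × GP j
  join (yes b≼a) _         _           _           = a , (inj₁ refl , b≼a , λ _ a≼c _ → a≼c) , gpA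
  join (no _)    (yes a≼b) _           _           = b , (a≼b , inj₁ refl , λ _ _ b≼c → b≼c) , gpB
  join (no b⋠a)  (no a⋠b)  (e , eIdem) (f , fIdem) =
    [ e ∨ f ] , join-of-incomparable b⋠a a⋠b eIdem fIdem , idempotent⇒GP (∨-idempotent (idempotent eIdem) (idempotent fIdem))
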